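{- For every positive integer $\ell$, $$3^\ell\le\kappa(\ell K_2)\le 4^\ell.$$
   Context: A natural graph is a simple graph whose vertex set is a finite subset of $\mathbb{N}=\{1,2,\dots\}$. An infinite permutation of $\mathbb{N}$ is a sequence $(\pi(1),\pi(2),\dots)$ in which every positive integer occurs exactly once. For a natural graph $G$, two infinite permutations $\pi,\sigma$ are $G$-different if $\{\pi(i),\sigma(i)\}\in E(G)$ for some $i$. $\kappa(G)$ is the maximum cardinality of a set of pairwise $G$-different infinite permutations. $\ell K_2$ denotes a natural graph consisting of $\ell$ pairwise vertex-disjoint edges and no other vertices. -}

module Defs where

open import Data.Nat using (ℕ; _≤_; _^_)
open import Data.Fin using (Fin)
open import Data.Product using (Σ; ∃; _×_)
open import Data.Sum using (_⊎_)
open import Relation.Binary.PropositionalEquality using (_≡_; _≢_)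
open import Relation.Nullary using (¬_)
open import Function.Bundles using (Bijection)
open import Function.Definitions using (Injective)
open import Relation.Binary.PropositionalEquality using (setoid)

-- An infinite permutation of ℕ⁺ = {1,2,...}: a bijection ℕ⁺ → ℕ⁺.
-- We represent ℕ⁺ by ℕ via the shift n ↦ n+1 (position i and value v of
-- the paper correspond to i-1 and v-1 here).
InfPerm : Set
InfPerm = Bijection (setoid ℕ) (setoid ℕ)

apply : InfPerm → ℕ → ℕ
apply π = Bijection.to π

-- The natural graph ℓK₂ (shifted by one): ℓ edges {a k, b k}, k : Fin ℓ,
-- pairwise vertex-disjoint, and no other vertices.
record Matching (ℓ : ℕ) : Set where
  field
    a : Fin ℓ → ℕ
    b : Fin ℓ → ℕ
    a-inj : Injective _≡_ _≡_ a
    b-inj : Injective _≡_ _≡_ b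
    a≢b   : ∀ i j → a i ≢ b j

open Matching public

IsEdge : {ℓ : ℕ} → Matching ℓ → ℕ → ℕ → Set
IsEdge {ℓ} M x y =
  Σ (Fin ℓ) λ k → ((x ≡ a M k) × (y ≡ b M k)) ⊎ ((x ≡ b M k) × (y ≡ a M k))

GDifferent : {ℓ : ℕ} → Matching ℓ → InfPerm → InfPerm → Set
GDifferent M π σ = Σ ℕ λ i → IsEdge M (apply π i) (apply σ i)

-- a family of m infinite permutations, pairwise G-different
-- (pairwise G-different permutations are automatically distinct, so this
-- is a set of cardinality m)
PairwiseGDifferent : {ℓ m : ℕ} → Matching ℓ → (Fin m → InfPerm) → Set
PairwiseGDifferent {m = m} M f = (i j : Fin m) → i ≢ j → GDifferent M (f i) (f j)

κ≥ : {ℓ : ℕ} → Matching ℓ → ℕ → Set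
κ≥ M n = Σ (Fin n → InfPerm) λ f → PairwiseGDifferent M f

κ≤ : {ℓ : ℕ} → Matching ℓ → ℕ → Set
κ≤ M n = (m : ℕ) (f : Fin m → InfPerm) → PairwiseGDifferent M f → m ≤ n

-- For the upper bound, let an infinite permutation π induce the partial binary word
-- p ↦ side of the matching containing π(p) (undefined off the matching). Since π is
-- injective, this word is defined at most 2ℓ times, and G-different permutations
-- give words that clash (0 against 1) at some position. For N beyond all clash
-- positions, the binary words of length N extending pairwise clashing partial
-- words are distinct, so Kraft's inequality gives at most 2^N / 2^(N − 2ℓ) = 4^ℓ
-- permutations.
--
-- For the lower bound, complete every edge {a k, b k} to a triangle with a fresh
-- vertex, and for t : Fin ℓ → Fin 3 rotate the k-th triangle by t k steps. When
-- t k ≠ t′ k the two rotations of the k-th triangle differ, so some vertex is sent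
-- to a k by one and to b k by the other.
module Submission where

open import Defs
open import Data.Bool using (Bool; true; false; not; T)
open import Data.Bool.Properties using (T?)
open import Data.Empty using (⊥-elim)
open import Data.Fin using (Fin; zero; suc; toℕ; finToFun; funToFin; combine)
open import Data.Fin.Properties using (any?; toℕ-injective; funToFin-finToFin; ¬∀⟶∃¬; injective⇒≤)
  renaming (_≟_ to _≟ᶠ_)
open import Data.List using (List; []; _∷_; _++_; map; filter; filterᵇ; length; lookup; tabulate; downFrom)
open import Data.List.Properties using (length-map; length-tabulate; length-++)
open import Data.List.Membership.Propositional using (_∈_)
open import Data.List.Membership.Propositional.Properties using (∈-lookup; ∈-++⁺ˡ; ∈-++⁺ʳ; ∈-tabulate⁺)
open import Data.List.Relation.Unary.All as All using (All; []; _∷_)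
open import Data.List.Relation.Unary.All.Properties using (all-filter; filter⁺)
import Data.List.Relation.Unary.All.Properties as All
open import Data.List.Relation.Unary.AllPairs using (AllPairs; []; _∷_)
import Data.List.Relation.Unary.AllPairs.Properties as AllPairs
open import Data.List.Relation.Unary.Any using (index)
open import Data.List.Relation.Unary.Any.Properties using (lookup-index)
open import Data.List.Relation.Unary.Unique.Propositional using (Unique)
import Data.List.Relation.Unary.Unique.Propositional.Properties as Unique
open import Data.Maybe using (Maybe; just; nothing; is-just)
open import Data.Nat using (ℕ; zero; suc; _+_; _*_; _^_; _⊔_; _≤_; _<_; z≤n; s≤s; s≤s⁻¹)
open import Data.Nat.ListAction using (sum)
open import Data.Nat.Properties
open import Data.Nat.Tactic.RingSolver using (solve-∀)
open import Data.Product using (Σ; ∃; _×_; _,_; proj₁; proj₂)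
open import Data.Sum using (_⊎_; inj₁; inj₂)
open import Function using (_∘_; id; _↔_; Inverse)
open import Function.Bundles using (Bijection; mk↔ₛ′)
open import Function.Definitions using (Injective)
open import Function.Properties.Inverse using (↔⇒⤖)
open import Relation.Binary.PropositionalEquality
open import Relation.Nullary using (¬_; Dec; yes; no)
open import Relation.Nullary.Decidable using (map′)
open import Relation.Unary using (Pred; Decidable)

<-bound : ∀ {n} (f : Fin n → ℕ) → Σ ℕ λ N → ∀ i → f i < N
<-bound {zero}  f = 0 , λ ()
<-bound {suc n} f with <-bound (f ∘ suc)
... | N , f<N = suc (f zero) ⊔ N , λ { zero → m≤m⊔n _ N ; (suc i) → ≤-trans (f<N i) (m≤n⊔m _ N) }

bounded-witnesses : ∀ {m p} {P : Fin m → Fin m → ℕ → Set p} →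
  (∀ i j → i ≢ j → ∃ (P i j)) → Σ ℕ λ N → ∀ i j → i ≢ j → Σ ℕ λ n → n < N × P i j n
bounded-witnesses {m} {P = P} witness = N , bounded
  where
  position : Fin m → Fin m → ℕ
  position i j with i ≟ᶠ j
  ... | yes _   = 0
  ... | no  i≢j = proj₁ (witness i j i≢j)

  rowBound : Fin m → ℕ
  rowBound i = proj₁ (<-bound (position i))

  N : ℕ
  N = proj₁ (<-bound rowBound)

  position<N : ∀ i j → position i j < N
  position<N i j = <-trans (proj₂ (<-bound (position i)) j) (proj₂ (<-bound rowBound) i)

  bounded : ∀ i j → i ≢ j → Σ ℕ λ n → n < N × P i j n
  bounded i j i≢j with i ≟ᶠ j | position<N i j
  ... | yes i≡j  | _   = ⊥-elim (i≢j i≡j)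
  ... | no  i≢j′ | n<N = proj₁ (witness i j i≢j′) , n<N , proj₂ (witness i j i≢j′)

module _ {a} {A : Set a} where

  Unique-lookup-injective : ∀ {xs : List A} → Unique xs →
    ∀ i j → lookup xs i ≡ lookup xs j → i ≡ j
  Unique-lookup-injective (x∉xs ∷ _)  zero    zero    _  = refl
  Unique-lookup-injective (x∉xs ∷ _)  zero    (suc j) eq = ⊥-elim (All.lookup x∉xs (∈-lookup j) eq)
  Unique-lookup-injective (x∉xs ∷ _)  (suc i) zero    eq = ⊥-elim (All.lookup x∉xs (∈-lookup i) (sym eq))
  Unique-lookup-injective (_    ∷ xs!) (suc i) (suc j) eq = cong suc (Unique-lookup-injective xs! i j eq)

  Unique-length≤ : ∀ {xs ys : List A} → Unique xs → All (_∈ ys) xs → length xs ≤ length ys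
  Unique-length≤ {xs} {ys} xs! xs⊆ys = injective⇒≤ position-injective
    where
    position : Fin (length xs) → Fin (length ys)
    position i = index (All.lookup xs⊆ys (∈-lookup i))

    position-injective : Injective _≡_ _≡_ position
    position-injective {i} {j} eq = Unique-lookup-injective xs! i j (begin
      lookup xs i            ≡⟨ lookup-index (All.lookup xs⊆ys (∈-lookup i)) ⟩
      lookup ys (position i) ≡⟨ cong (lookup ys) eq ⟩
      lookup ys (position j) ≡⟨ lookup-index (All.lookup xs⊆ys (∈-lookup j)) ⟨
      lookup xs j            ∎)
      where open ≡-Reasoning

length*≤sum* : ∀ {a} {A : Set a} c k (h : A → ℕ) {xs} →
  All (λ x → c ≤ h x * k) xs → length xs * c ≤ sum (map h xs) * k
length*≤sum* c k h []                       = z≤n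
length*≤sum* c k h {x ∷ xs} (c≤hx*k ∷ rest) = begin
  c + length xs * c           ≤⟨ +-mono-≤ c≤hx*k (length*≤sum* c k h rest) ⟩
  h x * k + sum (map h xs) * k ≡⟨ *-distribʳ-+ k (h x) _ ⟨
  (h x + sum (map h xs)) * k   ∎
  where open ≤-Reasoning

module _ {a r s p} {A : Set a} {R : A → A → Set r} {S : A → A → Set s}
         {P : Pred A p} (P? : Decidable P) where

  AllPairs-filter-restrict : (∀ {x y} → P x → P y → R x y → S x y) →
    ∀ {xs} → AllPairs R xs → AllPairs S (filter P? xs)
  AllPairs-filter-restrict restrict {[]}     []           = []
  AllPairs-filter-restrict restrict {x ∷ xs} (Rx ∷ Rxs) with P? x
  ... | no  _  = AllPairs-filter-restrict restrict Rxs
  ... | yes Px = All.zipWith (λ (Rxy , Py) → restrict Px Py Rxy)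
                   (filter⁺ P? Rx , all-filter P? xs)
               ∷ AllPairs-filter-restrict restrict Rxs

PartialWord : Set
PartialWord = ℕ → Maybe Bool

Clash : PartialWord → PartialWord → ℕ → Set
Clash q q′ p = Σ Bool λ c → q p ≡ just c × q′ p ≡ just (not c)

ClashBelow : ℕ → PartialWord → PartialWord → Set
ClashBelow N q q′ = Σ ℕ λ p → p < N × Clash q q′ p

freedom : Maybe Bool → ℕ
freedom nothing  = 2
freedom (just _) = 1

-- 2 ^ (number of undefined letters of q below N): the number of binary words of
-- length N extending q.
weight : ℕ → PartialWord → ℕ
weight zero    q = 1
weight (suc n) q = freedom (q n) * weight n q

admits : Bool → Maybe Bool → Bool
admits true  (just false) = false
admits false (just true)  = false
admits _     _            = true

Admits : Bool → ℕ → PartialWord → Set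
Admits c n q = T (admits c (q n))

admits? : ∀ c n → Decidable (Admits c n)
admits? c n q = T? (admits c (q n))

halfWeight : Bool → ℕ → List PartialWord → ℕ
halfWeight c n qs = sum (map (weight n) (filter (admits? c n) qs))

weight-split : ∀ n qs →
  sum (map (weight (suc n)) qs) ≡ halfWeight false n qs + halfWeight true n qs
weight-split n []       = refl
weight-split n (q ∷ qs) with q n | weight-split n qs
... | nothing    | eq = trans (cong (2 * weight n q +_) eq)
                              (lemma (weight n q) (halfWeight false n qs) (halfWeight true n qs))
  where
  lemma : ∀ w x y → 2 * w + (x + y) ≡ (w + x) + (w + y)
  lemma = solve-∀
... | just false | eq = trans (cong (1 * weight n q +_) eq)
                              (lemma (weight n q) (halfWeight false n qs) (halfWeight true n qs))
  where
  lemma : ∀ w x y → 1 * w + (x + y) ≡ (w + x) + y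
  lemma = solve-∀
... | just true  | eq = trans (cong (1 * weight n q +_) eq)
                              (lemma (weight n q) (halfWeight false n qs) (halfWeight true n qs))
  where
  lemma : ∀ w x y → 1 * w + (x + y) ≡ x + (w + y)
  lemma = solve-∀

admitting-no-clash : ∀ c n {q q′} → Admits c n q → Admits c n q′ → ¬ Clash q q′ n
admitting-no-clash c n {q} {q′} adm adm′ (c′ , eq , eq′)
  rewrite eq | eq′ with c | c′
... | false | false = adm′
... | false | true  = adm
... | true  | false = adm
... | true  | true  = adm′

-- Split the family by the letter admitted at position n: each half clashes below n,
-- and a word undefined at n lies in both halves, as its freedom 2 requires.
kraft : ∀ N qs → AllPairs (ClashBelow N) qs → sum (map (weight N) qs) ≤ 2 ^ N
kraft zero    []                         _ = z≤n
kraft zero    (q ∷ [])                   _ = s≤s z≤n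
kraft zero    (q ∷ q′ ∷ _) (((_ , () , _) ∷ _) ∷ _)
kraft (suc n) qs clashing = begin
  sum (map (weight (suc n)) qs)   ≡⟨ weight-split n qs ⟩
  halfWeight false n qs + halfWeight true n qs
                                  ≤⟨ +-mono-≤ (kraft n _ (half false)) (kraft n _ (half true)) ⟩
  2 ^ n + 2 ^ n                   ≡⟨ cong (2 ^ n +_) (sym (+-identityʳ (2 ^ n))) ⟩
  2 ^ suc n                       ∎
  where
  open ≤-Reasoning
  half : ∀ c → AllPairs (ClashBelow n) (filter (admits? c n) qs)
  half c = AllPairs-filter-restrict (admits? c n) restrict clashing
    where
    restrict : ∀ {q q′} → Admits c n q → Admits c n q′ → ClashBelow (suc n) q q′ → ClashBelow n q q′
    restrict {q} {q′} adm adm′ (p , p<1+n , clash) =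
      p , ≤∧≢⇒< (s≤s⁻¹ p<1+n) (λ { refl → admitting-no-clash c p {q} {q′} adm adm′ clash }) , clash

definedBelow : ℕ → PartialWord → ℕ
definedBelow N q = length (filterᵇ (is-just ∘ q) (downFrom N))

weight-definedBelow : ∀ N q → weight N q * 2 ^ definedBelow N q ≡ 2 ^ N
weight-definedBelow zero    q = refl
weight-definedBelow (suc n) q with q n
... | nothing = trans (*-assoc 2 (weight n q) _) (cong (2 *_) (weight-definedBelow n q))
... | just _  = trans (lemma (weight n q) _) (cong (2 *_) (weight-definedBelow n q))
  where
  lemma : ∀ w e → 1 * w * (2 * e) ≡ 2 * (w * e)
  lemma = solve-∀

2^N≤weight*2^d : ∀ N d q → definedBelow N q ≤ d → 2 ^ N ≤ weight N q * 2 ^ d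
2^N≤weight*2^d N d q defined≤d = begin
  2 ^ N                               ≡⟨ weight-definedBelow N q ⟨
  weight N q * 2 ^ definedBelow N q   ≤⟨ *-monoʳ-≤ (weight N q) (^-monoʳ-≤ 2 defined≤d) ⟩
  weight N q * 2 ^ d                  ∎
  where open ≤-Reasoning

clashing-length≤2^ : ∀ N d qs → AllPairs (ClashBelow N) qs →
  All (λ q → definedBelow N q ≤ d) qs → length qs ≤ 2 ^ d
clashing-length≤2^ N d qs clashing fewDefined =
  *-cancelʳ-≤ (length qs) (2 ^ d) (2 ^ N) {{m^n≢0 2 N}} (begin
    length qs * 2 ^ N              ≤⟨ length*≤sum* (2 ^ N) (2 ^ d) (weight N)
                                        (All.map (2^N≤weight*2^d N d _) fewDefined) ⟩
    sum (map (weight N) qs) * 2 ^ d ≤⟨ *-monoˡ-≤ (2 ^ d) (kraft N qs clashing) ⟩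
    2 ^ N * 2 ^ d                  ≡⟨ *-comm (2 ^ N) (2 ^ d) ⟩
    2 ^ d * 2 ^ N                  ∎)
  where open ≤-Reasoning

definedBelow∘injective≤ : ∀ (s : ℕ → Maybe Bool) (g : ℕ → ℕ) (V : List ℕ) →
  Injective _≡_ _≡_ g → (∀ v → T (is-just (s v)) → v ∈ V) →
  ∀ N → definedBelow N (s ∘ g) ≤ length V
definedBelow∘injective≤ s g V g-inj support N = begin
  length ps         ≡⟨ length-map g ps ⟨
  length (map g ps) ≤⟨ Unique-length≤ (Unique.map⁺ g-inj ps!) (All.map⁺ (All.map (support _) ps-defined)) ⟩
  length V          ∎
  where
  open ≤-Reasoning
  ps : List ℕ
  ps = filterᵇ (is-just ∘ s ∘ g) (downFrom N)

  ps! : Unique ps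
  ps! = Unique.filter⁺ (T? ∘ is-just ∘ s ∘ g) (Unique.downFrom⁺ N)

  ps-defined : All (T ∘ is-just ∘ s ∘ g) ps
  ps-defined = all-filter (T? ∘ is-just ∘ s ∘ g) (downFrom N)

module Extension {a} {X : Set a} (e : X → ℕ) (e-inj : Injective _≡_ _≡_ e)
                 (image? : ∀ n → Dec (∃ λ x → e x ≡ n)) where

  extendMap : (X → X) → ℕ → ℕ
  extendMap ρ n with image? n
  ... | yes (x , _) = e (ρ x)
  ... | no  _       = n

  extendMap-e : ∀ ρ x → extendMap ρ (e x) ≡ e (ρ x)
  extendMap-e ρ x with image? (e x)
  ... | yes (x′ , ex′≡ex) = cong (e ∘ ρ) (e-inj ex′≡ex)
  ... | no  ∉image        = ⊥-elim (∉image (x , refl))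

  extendMap-outside : ∀ ρ n → ¬ (∃ λ x → e x ≡ n) → extendMap ρ n ≡ n
  extendMap-outside ρ n ∉image with image? n
  ... | yes ∈image = ⊥-elim (∉image ∈image)
  ... | no  _      = refl

  extendMap-inverse : ∀ ρ σ → (∀ x → ρ (σ x) ≡ x) → ∀ n → extendMap ρ (extendMap σ n) ≡ n
  extendMap-inverse ρ σ inv n with image? n
  ... | yes (x , refl) = trans (extendMap-e ρ (σ x)) (cong e (inv x))
  ... | no  ∉image     = extendMap-outside ρ n ∉image

  extend : X ↔ X → ℕ ↔ ℕ
  extend ρ = mk↔ₛ′ (extendMap to) (extendMap from)
    (extendMap-inverse to from strictlyInverseˡ) (extendMap-inverse from to strictlyInverseʳ)
    where open Inverse ρ

funToFin-cong : ∀ {m n} {f g : Fin m → Fin n} → (∀ i → f i ≡ g i) → funToFin f ≡ funToFin g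
funToFin-cong {zero}  f≗g = refl
funToFin-cong {suc m} f≗g = cong₂ combine (f≗g zero) (funToFin-cong (f≗g ∘ suc))

finToFun-injective : ∀ {m n} {i j : Fin (m ^ n)} →
  (∀ k → finToFun {m} {n} i k ≡ finToFun j k) → i ≡ j
finToFun-injective {m} {n} {i} {j} same = begin
  i                                ≡⟨ funToFin-finToFin {n} {m} i ⟨
  funToFin (finToFun {m} {n} i)    ≡⟨ funToFin-cong same ⟩
  funToFin (finToFun {m} {n} j)    ≡⟨ funToFin-finToFin {n} {m} j ⟩
  j                                ∎
  where open ≡-Reasoning

finToFun-separates : ∀ {m n} {i j : Fin (m ^ n)} → i ≢ j →
  ∃ λ k → finToFun {m} {n} i k ≢ finToFun j k
finToFun-separates {m} {n} {i} {j} i≢j =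
  ¬∀⟶∃¬ n _ (λ k → finToFun i k ≟ᶠ finToFun j k) (i≢j ∘ finToFun-injective)

next : Fin 3 → Fin 3
next zero             = suc zero
next (suc zero)       = suc (suc zero)
next (suc (suc zero)) = zero

rotate : Fin 3 → Fin 3 → Fin 3
rotate zero             = id
rotate (suc zero)       = next
rotate (suc (suc zero)) = next ∘ next

rotate³ : ∀ u r → rotate u (rotate u (rotate u r)) ≡ r
rotate³ zero             r                = refl
rotate³ (suc zero)       zero             = refl
rotate³ (suc zero)       (suc zero)       = refl
rotate³ (suc zero)       (suc (suc zero)) = refl
rotate³ (suc (suc zero)) zero             = refl
rotate³ (suc (suc zero)) (suc zero)       = refl
rotate³ (suc (suc zero)) (suc (suc zero)) = refl

rotations-separate : ∀ {u v} → u ≢ v → Σ (Fin 3) λ r →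
  (rotate u r ≡ zero × rotate v r ≡ suc zero) ⊎ (rotate u r ≡ suc zero × rotate v r ≡ zero)
rotations-separate {zero}           {zero}           u≢v = ⊥-elim (u≢v refl)
rotations-separate {zero}           {suc zero}       _   = zero , inj₁ (refl , refl)
rotations-separate {zero}           {suc (suc zero)} _   = suc zero , inj₂ (refl , refl)
rotations-separate {suc zero}       {zero}           _   = zero , inj₂ (refl , refl)
rotations-separate {suc zero}       {suc zero}       u≢v = ⊥-elim (u≢v refl)
rotations-separate {suc zero}       {suc (suc zero)} _   = suc (suc zero) , inj₁ (refl , refl)
rotations-separate {suc (suc zero)} {zero}           _   = suc zero , inj₁ (refl , refl)
rotations-separate {suc (suc zero)} {suc zero}       _   = suc (suc zero) , inj₂ (refl , refl)
rotations-separate {suc (suc zero)} {suc (suc zero)} u≢v = ⊥-elim (u≢v refl)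

module _ {ℓ} (M : Matching ℓ) where

  side : ℕ → Maybe Bool
  side v with any? (λ k → a M k ≟ v) | any? (λ k → b M k ≟ v)
  ... | yes _ | _     = just false
  ... | no  _ | yes _ = just true
  ... | no  _ | no  _ = nothing

  side-a : ∀ k → side (a M k) ≡ just false
  side-a k with any? (λ k′ → a M k′ ≟ a M k) | any? (λ k′ → b M k′ ≟ a M k)
  ... | yes _ | _ = refl
  ... | no ∉A | _ = ⊥-elim (∉A (k , refl))

  side-b : ∀ k → side (b M k) ≡ just true
  side-b k with any? (λ k′ → a M k′ ≟ b M k) | any? (λ k′ → b M k′ ≟ b M k)
  ... | yes (k′ , eq) | _     = ⊥-elim (a≢b M k′ k eq)
  ... | no  _         | yes _ = refl
  ... | no  _         | no ∉B = ⊥-elim (∉B (k , refl))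

  vertices : List ℕ
  vertices = tabulate (a M) ++ tabulate (b M)

  side-support : ∀ v → T (is-just (side v)) → v ∈ vertices
  side-support v with any? (λ k → a M k ≟ v) | any? (λ k → b M k ≟ v)
  ... | yes (k , refl) | _              = λ _ → ∈-++⁺ˡ (∈-tabulate⁺ k)
  ... | no  _          | yes (k , refl) = λ _ → ∈-++⁺ʳ (tabulate (a M)) (∈-tabulate⁺ k)
  ... | no  _          | no  _          = λ ()

  edge-clash : ∀ {x y} → IsEdge M x y → Σ Bool λ c → side x ≡ just c × side y ≡ just (not c)
  edge-clash (k , inj₁ (refl , refl)) = false , side-a k , side-b k
  edge-clash (k , inj₂ (refl , refl)) = true , side-b k , side-a k

  length-vertices : length vertices ≡ ℓ + ℓ
  length-vertices = trans (length-++ (tabulate (a M)))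
                          (cong₂ _+_ (length-tabulate (a M)) (length-tabulate (b M)))

  2^|vertices|≡4^ℓ : 2 ^ length vertices ≡ 4 ^ ℓ
  2^|vertices|≡4^ℓ = begin
    2 ^ length vertices  ≡⟨ cong (2 ^_) length-vertices ⟩
    2 ^ (ℓ + ℓ)          ≡⟨ cong (λ n → 2 ^ (ℓ + n)) (+-identityʳ ℓ) ⟨
    2 ^ (2 * ℓ)          ≡⟨ ^-*-assoc 2 2 ℓ ⟨
    4 ^ ℓ                ∎
    where open ≡-Reasoning

  κ≤4^ℓ : κ≤ M (4 ^ ℓ)
  κ≤4^ℓ m f differ = begin
    m                        ≡⟨ length-tabulate words ⟨
    length (tabulate words)  ≤⟨ clashing-length≤2^ N (length vertices) (tabulate words)
                                  (AllPairs.tabulate⁺ clashing) (All.tabulate⁺ fewDefined) ⟩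
    2 ^ length vertices      ≡⟨ 2^|vertices|≡4^ℓ ⟩
    4 ^ ℓ                    ∎
    where
    open ≤-Reasoning
    words : Fin m → PartialWord
    words i = side ∘ apply (f i)

    N : ℕ
    N = proj₁ (bounded-witnesses differ)

    clashing : ∀ {i j} → i ≢ j → ClashBelow N (words i) (words j)
    clashing {i} {j} i≢j with proj₂ (bounded-witnesses differ) i j i≢j
    ... | p , p<N , edge = p , p<N , edge-clash edge

    fewDefined : ∀ i → definedBelow N (words i) ≤ length vertices
    fewDefined i = definedBelow∘injective≤ side (apply (f i)) vertices
                     (Bijection.injective (f i)) side-support N

module _ {ℓ} (M : Matching ℓ) where

  private
    S : ℕ
    S = proj₁ (<-bound (λ k → a M k ⊔ b M k))

    a<S : ∀ k → a M k < S
    a<S k = ≤-trans (s≤s (m≤m⊔n (a M k) (b M k))) (proj₂ (<-bound (λ k → a M k ⊔ b M k)) k)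

    b<S : ∀ k → b M k < S
    b<S k = ≤-trans (s≤s (m≤n⊔m (a M k) (b M k))) (proj₂ (<-bound (λ k → a M k ⊔ b M k)) k)

  fresh : Fin ℓ → ℕ
  fresh k = S + toℕ k

  triangle : Fin ℓ × Fin 3 → ℕ
  triangle (k , zero)             = a M k
  triangle (k , suc zero)         = b M k
  triangle (k , suc (suc zero))   = fresh k

  private
    <S⇒≢fresh : ∀ {v} k → v < S → v ≢ fresh k
    <S⇒≢fresh k v<S = <⇒≢ (≤-trans v<S (m≤m+n S (toℕ k)))

  triangle-injective : Injective _≡_ _≡_ triangle
  triangle-injective {k , zero}           {k′ , zero}           eq = cong (_, zero) (a-inj M eq)
  triangle-injective {k , zero}           {k′ , suc zero}       eq = ⊥-elim (a≢b M k k′ eq)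
  triangle-injective {k , zero}           {k′ , suc (suc zero)} eq = ⊥-elim (<S⇒≢fresh k′ (a<S k) eq)
  triangle-injective {k , suc zero}       {k′ , zero}           eq = ⊥-elim (a≢b M k′ k (sym eq))
  triangle-injective {k , suc zero}       {k′ , suc zero}       eq = cong (_, suc zero) (b-inj M eq)
  triangle-injective {k , suc zero}       {k′ , suc (suc zero)} eq = ⊥-elim (<S⇒≢fresh k′ (b<S k) eq)
  triangle-injective {k , suc (suc zero)} {k′ , zero}           eq = ⊥-elim (<S⇒≢fresh k (a<S k′) (sym eq))
  triangle-injective {k , suc (suc zero)} {k′ , suc zero}       eq = ⊥-elim (<S⇒≢fresh k (b<S k′) (sym eq))
  triangle-injective {k , suc (suc zero)} {k′ , suc (suc zero)} eq =
    cong (_, suc (suc zero)) (toℕ-injective (+-cancelˡ-≡ S _ _ eq))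

  triangle? : ∀ n → Dec (∃ λ x → triangle x ≡ n)
  triangle? n = map′ (λ (k , r , eq) → (k , r) , eq) (λ ((k , r) , eq) → k , r , eq)
    (any? λ k → any? λ r → triangle (k , r) ≟ n)

  rotation : (Fin ℓ → Fin 3) → (Fin ℓ × Fin 3) ↔ (Fin ℓ × Fin 3)
  rotation t = mk↔ₛ′ turn (turn ∘ turn) turn³ turn³
    where
    turn : Fin ℓ × Fin 3 → Fin ℓ × Fin 3
    turn (k , r) = k , rotate (t k) r
    turn³ : ∀ x → turn (turn (turn x)) ≡ x
    turn³ (k , r) = cong (k ,_) (rotate³ (t k) r)

  open Extension triangle triangle-injective triangle? using (extend; extendMap-e)

  rotationPerm : (Fin ℓ → Fin 3) → InfPerm
  rotationPerm t = ↔⇒⤖ (extend (rotation t))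

  rotationPerm-triangle : ∀ t k r →
    apply (rotationPerm t) (triangle (k , r)) ≡ triangle (k , rotate (t k) r)
  rotationPerm-triangle t k r = extendMap-e _ (k , r)

  κ≥3^ℓ : κ≥ M (3 ^ ℓ)
  κ≥3^ℓ = perm , differ
    where
    perm : Fin (3 ^ ℓ) → InfPerm
    perm = rotationPerm ∘ finToFun {3} {ℓ}

    moves : ∀ i k r {s} → rotate (finToFun {3} {ℓ} i k) r ≡ s →
      apply (perm i) (triangle (k , r)) ≡ triangle (k , s)
    moves i k r eq = trans (rotationPerm-triangle (finToFun i) k r) (cong (triangle ∘ (k ,_)) eq)

    differ : PairwiseGDifferent M perm
    differ i j i≢j with finToFun-separates {3} {ℓ} i≢j
    ... | k , tᵢk≢tⱼk with rotations-separate tᵢk≢tⱼk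
    ... | r , inj₁ (eqᵢ , eqⱼ) = triangle (k , r) , k , inj₁ (moves i k r eqᵢ , moves j k r eqⱼ)
    ... | r , inj₂ (eqᵢ , eqⱼ) = triangle (k , r) , k , inj₂ (moves i k r eqᵢ , moves j k r eqⱼ)

-- Both bounds hold for ℓ = 0 as well.
proposition3 : (ℓ : ℕ) → 1 ≤ ℓ → (M : Matching ℓ) →
    κ≥ M (3 ^ ℓ) × κ≤ M (4 ^ ℓ)
proposition3 ℓ _ M = κ≥3^ℓ M , κ≤4^ℓ M
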